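{- Let $B\in\mathbb{F}_2^{m\times m}$. Then the following are equivalent: (i) $t(I,B)=0$; (ii) there exist $L_1,L_2\in\mathcal{L}$ such that $B=L_1JL_2$.
   Context: $\mathbb{F}_2=\{0,1\}$ is the field with two elements and $\mathbb{F}_2^{m\times m}$ the set of $m\times m$ matrices over $\mathbb{F}_2$; $I$ is the identity matrix. For $C_1,\dots,C_s\in\mathbb{F}_2^{m\times m}$, the digital net generated by $(C_1,\dots,C_s)$ is the point set $\{\mathbf{x}_0,\dots,\mathbf{x}_{2^m-1}\}\subset[0,1)^s$ defined as follows: for $0\le l<2^m$ write $l=\iota_0+\iota_1 2+\dots+\iota_{m-1}2^{m-1}$ with $\iota_k\in\mathbb{F}_2$, put $\mathbf{y}_{l,j}=C_j(\iota_0,\dots,\iota_{m-1})^\top\in\mathbb{F}_2^m$ and $\mathbf{x}_l=(\phi(\mathbf{y}_{l,1}),\dots,\phi(\mathbf{y}_{l,s}))$, where $\phi((y_1,\dots,y_m)^\top)=\sum_{k=1}^m y_k 2^{ -k}$. For $0\le t\le m$, a point set $\{\mathbf{x}_0,\dots,\mathbf{x}_{2^m-1}\}\subset[0,1)^s$ is a $(t,m,s)$-net over $\mathbb{F}_2$ if for all nonnegative integers $d_1,\dots,d_s$ with $d_1+\dots+d_s=m-t$, every elementary interval $\prod_{i=1}^s[a_i/2^{d_i},(a_i+1)/2^{d_i})$ with integers $0\le a_i<2^{d_i}$ contains exactly $2^t$ of the points (counted with multiplicity). $t(C_1,\dots,C_s)$ denotes the $t$-value of the digital net generated by $(C_1,\dots,C_s)$,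 i.e. the least $t$ for which it is a $(t,m,s)$-net over $\mathbb{F}_2$. $J$ is the $m\times m$ anti-diagonal matrix with all anti-diagonal entries $1$ (and all other entries $0$). $\mathcal{L}$ denotes the set of non-singular lower-triangular $m\times m$ matrices over $\mathbb{F}_2$ (i.e. lower-triangular with all diagonal entries $1$). -}

module Defs where

open import Data.Bool using (Bool; true; false; _∧_; _xor_; if_then_else_)
open import Data.Nat using (ℕ; zero; suc; _+_; _*_; _∸_; _^_; _≤_; _<_; _≤ᵇ_; _<ᵇ_; _≡ᵇ_)
open import Data.Nat.DivMod using (_/_; _%_)
open import Data.Fin using (Fin; toℕ) renaming (zero to fz; suc to fs)
open import Data.Product using (_×_; Σ; ∃; ∃-syntax)
open import Relation.Binary.PropositionalEquality using (_≡_)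
open import Relation.Nullary using (¬_)

-- F₂ is Bool, with addition = xor and multiplication = ∧.
F2 : Set
F2 = Bool

Mat : ℕ → Set
Mat m = Fin m → Fin m → F2

sumF2 : ∀ n → (Fin n → F2) → F2
sumF2 zero f = false
sumF2 (suc n) f = f fz xor sumF2 n (λ i → f (fs i))

sumℕ : ∀ n → (Fin n → ℕ) → ℕ
sumℕ zero f = 0
sumℕ (suc n) f = f fz + sumℕ n (λ i → f (fs i))

allB : ∀ n → (Fin n → Bool) → Bool
allB zero f = true
allB (suc n) f = f fz ∧ allB n (λ i → f (fs i))

matMul : ∀ {m} → Mat m → Mat m → Mat m
matMul {m} A B i j = sumF2 m (λ k → A i k ∧ B k j)

matVec : ∀ {m} → Mat m → (Fin m → F2) → Fin m → F2
matVec {m} A v i = sumF2 m (λ k → A i k ∧ v k)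

idMat : ∀ {m} → Mat m
idMat i j = toℕ i ≡ᵇ toℕ j

antiDiag : ∀ {m} → Mat m
antiDiag {m} i j = (toℕ i + toℕ j) ≡ᵇ (m ∸ 1)

-- non-singular lower-triangular: zero above the diagonal, ones on it
IsUnitLower : ∀ {m} → Mat m → Set
IsUnitLower {m} L =
  (∀ (i j : Fin m) → toℕ i < toℕ j → L i j ≡ false) × (∀ (i : Fin m) → L i i ≡ true)

-- k-th binary digit ι_k of l (l = Σ ι_k 2^k)
digit : ℕ → ℕ → F2
digit l zero = (l % 2) ≡ᵇ 1
digit l (suc k) = digit (l / 2) k

digits : ∀ m → ℕ → Fin m → F2
digits m l k = digit l (toℕ k)

-- 2^m · φ(y), where φ(y) = Σ_{k=1}^m y_k 2^{-k}; with 0-based index k this is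
-- Σ_k y_k 2^{m-1-k}.  So φ(y) = phiNum y / 2^m.
phiNum : ∀ m → (Fin m → F2) → ℕ
phiNum m y = sumℕ m (λ k → if y k then 2 ^ (m ∸ suc (toℕ k)) else 0)

-- numerator (over 2^m) of the j-th coordinate of the point x_l of the digital net
-- generated by C
netCoord : ∀ m s → (Fin s → Mat m) → ℕ → Fin s → ℕ
netCoord m s C l j = phiNum m (matVec (C j) (digits m l))

count : (ℕ → Bool) → ℕ → ℕ
count p zero = 0
count p (suc n) = (if p n then 1 else 0) + count p n

-- For d ≤ m:  N / 2^m ∈ [a/2^d, (a+1)/2^d)  ⇔  a·2^{m-d} ≤ N < (a+1)·2^{m-d}.
inInterval : ℕ → ℕ → ℕ → ℕ → Bool
inInterval m d a N = ((a * 2 ^ (m ∸ d)) ≤ᵇ N) ∧ (N <ᵇ (suc a * 2 ^ (m ∸ d)))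

IsNet : ∀ m s → (Fin s → Mat m) → ℕ → Set
IsNet m s C t =
  t ≤ m ×
  (∀ (d : Fin s → ℕ) → sumℕ s d ≡ m ∸ t →
   ∀ (a : Fin s → ℕ) → (∀ i → a i < 2 ^ d i) →
   count (λ l → allB s (λ i → inInterval m (d i) (a i) (netCoord m s C l i))) (2 ^ m)
     ≡ 2 ^ t)

HasTValue : ∀ m s → (Fin s → Mat m) → ℕ → Set
HasTValue m s C t = IsNet m s C t × (∀ t' → t' < t → ¬ IsNet m s C t')

pair : ∀ {m} → Mat m → Mat m → Fin 2 → Mat m
pair A B fz = A
pair A B (fs _) = B

{-# OPTIONS --safe #-}
module Submission where

-- Read in binary, the point x_l = (ι, Bι) of the net lies in the elementary box with
-- d₀ + d₁ = m determined by the first d₀ digits of ι and the first d₁ digits of Bι.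
-- So t(I, B) = 0 says exactly that each map ι ↦ (ι|d₀ , (Bι)|d₁) is a bijection
-- F₂^m → F₂^d₀ × F₂^d₁.  Injectivity for all splits says that every leading principal
-- submatrix of BJ is nonsingular, which yields an LU decomposition BJ = LU with unit
-- triangular factors; then B = LJ(JUJ) with JUJ unit lower triangular.  Conversely, if
-- B = L₁JL₂ and w = L₂ι, the first d₀ digits of ι correspond triangularly to those of w,
-- and the first d₁ digits of Bι = L₁(Jw) to the last d₁ digits of w; the two sets of
-- positions partition w, so every box is hit exactly once.

open import Defs
open import Algebra.Bundles using (CommutativeRing)
open import Data.Bool using (Bool; true; false; _∧_; _xor_; if_then_else_)
open import Data.Bool.Properties
  using (xor-∧-commutativeRing; xor-same; xor-comm; xor-assoc; xor-identityʳ; ∧-zeroʳ; ∧-identityʳ;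
         ∧-comm; ∧-assoc; ∧-distribˡ-xor; ∧-distribʳ-xor; ∧-conicalˡ; ∧-conicalʳ; T-≡; T-∧)
open import Data.Empty using (⊥-elim)
open import Data.Fin using (Fin; toℕ; opposite) renaming (zero to fz; suc to fs)
open import Data.Fin.Permutation using (reverse)
open import Data.Fin.Properties using (toℕ-injective; toℕ<n; opposite-prop; opposite-involutive)
  renaming (suc-injective to fs-injective)
open import Data.Nat
  using (ℕ; zero; suc; _+_; _*_; _∸_; _^_; _≤_; _<_; z≤n; s≤s; s≤s⁻¹; _<?_; _≤?_; _≡ᵇ_; NonZero)
open import Data.Nat.DivMod
  using (_/_; _%_; m≡m%n+[m/n]*n; m%n<n; [m+kn]%n≡m%n; m*n/n≡m; m/n*n≤m; m<n⇒m/n≡0;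
         m<n*o⇒m/o<n; /-monoˡ-≤; +-distrib-/-∣ˡ; +-distrib-/-∣ʳ)
open import Data.Nat.Divisibility using (n∣m*n)
open import Data.Nat.Properties
open import Data.Product using (_×_; _,_; proj₁; proj₂; ∃-syntax)
open import Data.Sum using (inj₁; inj₂)
open import Data.Vec.Functional using (_∷_; [])
open import Function using (_∘_)
open import Function.Bundles using (Equivalence; _⇔_; mk⇔)
open import Relation.Binary.Definitions using (tri<; tri≈; tri>)
open import Relation.Binary.PropositionalEquality
open import Relation.Nullary using (yes; no; contradiction)

open CommutativeRing xor-∧-commutativeRing using (semiring)
open import Algebra.Properties.Semiring.Sum semiring
  using (sum; sum-cong-≗; ∑-comm; ∑-distrib-+; *-distribˡ-sum; *-distribʳ-sum; sum-permute)

Bits : ℕ → Set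
Bits m = Fin m → F2

zeros : ∀ {m} → Bits m
zeros _ = false

_⊕_ : ∀ {m} → Bits m → Bits m → Bits m
(x ⊕ y) i = x i xor y i

xor≡false⇒≡ : ∀ a b → a xor b ≡ false → a ≡ b
xor≡false⇒≡ true  true  _ = refl
xor≡false⇒≡ false false _ = refl

xor-cancelˡ : ∀ a b → a xor (a xor b) ≡ b
xor-cancelˡ a b = trans (sym (xor-assoc a a b)) (cong (_xor b) (xor-same a))

sumF2≡sum : ∀ n (f : Bits n) → sumF2 n f ≡ sum f
sumF2≡sum zero    f = refl
sumF2≡sum (suc n) f = cong (f fz xor_) (sumF2≡sum n (f ∘ fs))

sumF2-cong : ∀ n {f g : Bits n} → f ≗ g → sumF2 n f ≡ sumF2 n g
sumF2-cong zero    f≗g = refl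
sumF2-cong (suc n) f≗g = cong₂ _xor_ (f≗g fz) (sumF2-cong n (f≗g ∘ fs))

sumF2-zeros : ∀ n {f : Bits n} → f ≗ zeros → sumF2 n f ≡ false
sumF2-zeros zero    f≗0 = refl
sumF2-zeros (suc n) f≗0 rewrite f≗0 fz = sumF2-zeros n (f≗0 ∘ fs)

sumF2-false : ∀ n → sumF2 n (λ _ → false) ≡ false
sumF2-false n = sumF2-zeros n (λ _ → refl)

sumF2-single : ∀ n (f : Bits n) p → (∀ i → i ≢ p → f i ≡ false) → sumF2 n f ≡ f p
sumF2-single (suc n) f fz     f≡0 =
  trans (cong (f fz xor_) (sumF2-zeros n (λ i → f≡0 (fs i) λ ()))) (xor-identityʳ (f fz))
sumF2-single (suc n) f (fs p) f≡0 rewrite f≡0 fz (λ ()) =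
  sumF2-single n (f ∘ fs) p (λ i i≢p → f≡0 (fs i) (i≢p ∘ fs-injective))

sumF2-xor : ∀ n (f g : Bits n) → sumF2 n (λ i → f i xor g i) ≡ sumF2 n f xor sumF2 n g
sumF2-xor n f g = begin
  sumF2 n (λ i → f i xor g i) ≡⟨ sumF2≡sum n _ ⟩
  sum (λ i → f i xor g i)     ≡⟨ ∑-distrib-+ f g ⟩
  sum f xor sum g             ≡⟨ cong₂ _xor_ (sumF2≡sum n f) (sumF2≡sum n g) ⟨
  sumF2 n f xor sumF2 n g     ∎
  where open ≡-Reasoning

sumF2-∧ˡ : ∀ n b (f : Bits n) → b ∧ sumF2 n f ≡ sumF2 n (λ i → b ∧ f i)
sumF2-∧ˡ n b f = begin
  b ∧ sumF2 n f           ≡⟨ cong (b ∧_) (sumF2≡sum n f) ⟩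
  b ∧ sum f               ≡⟨ *-distribˡ-sum b f ⟩
  sum (λ i → b ∧ f i)     ≡⟨ sumF2≡sum n _ ⟨
  sumF2 n (λ i → b ∧ f i) ∎
  where open ≡-Reasoning

sumF2-∧ʳ : ∀ n b (f : Bits n) → sumF2 n f ∧ b ≡ sumF2 n (λ i → f i ∧ b)
sumF2-∧ʳ n b f = begin
  sumF2 n f ∧ b           ≡⟨ cong (_∧ b) (sumF2≡sum n f) ⟩
  sum f ∧ b               ≡⟨ *-distribʳ-sum b f ⟩
  sum (λ i → f i ∧ b)     ≡⟨ sumF2≡sum n _ ⟨
  sumF2 n (λ i → f i ∧ b) ∎
  where open ≡-Reasoning

sumF2-comm : ∀ m n (f : Fin m → Fin n → F2) →
  sumF2 m (λ i → sumF2 n (f i)) ≡ sumF2 n (λ j → sumF2 m (λ i → f i j))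
sumF2-comm m n f = begin
  sumF2 m (λ i → sumF2 n (f i))        ≡⟨ sumF2≡sum m _ ⟩
  sum (λ i → sumF2 n (f i))            ≡⟨ sum-cong-≗ (λ i → sumF2≡sum n (f i)) ⟩
  sum (λ i → sum (f i))                ≡⟨ ∑-comm f ⟩
  sum (λ j → sum (λ i → f i j))        ≡⟨ sum-cong-≗ (λ j → sumF2≡sum m (λ i → f i j)) ⟨
  sum (λ j → sumF2 m (λ i → f i j))    ≡⟨ sumF2≡sum n _ ⟨
  sumF2 n (λ j → sumF2 m (λ i → f i j)) ∎
  where open ≡-Reasoning

sumF2-opposite : ∀ n (f : Bits n) → sumF2 n (f ∘ opposite) ≡ sumF2 n f
sumF2-opposite n f = begin
  sumF2 n (f ∘ opposite) ≡⟨ sumF2≡sum n _ ⟩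
  sum (f ∘ opposite)     ≡⟨ sum-permute f reverse ⟨
  sum f                  ≡⟨ sumF2≡sum n f ⟨
  sumF2 n f              ∎
  where open ≡-Reasoning

sumF2-select : ∀ n (S x : Bits n) p → (∀ k → S k ≡ true → k ≡ p) → S p ≡ true →
  sumF2 n (λ k → S k ∧ x k) ≡ x p
sumF2-select n S x p S⇒≡p Sp = trans (sumF2-single n _ p term≡false) (cong (_∧ x p) Sp)
  where
  term≡false : ∀ k → k ≢ p → S k ∧ x k ≡ false
  term≡false k k≢p with S k in Sk
  ... | true  = ⊥-elim (k≢p (S⇒≡p k Sk))
  ... | false = refl

matVec-cong : ∀ {m} (A : Mat m) {x y : Bits m} → x ≗ y → matVec A x ≗ matVec A y
matVec-cong {m} A x≗y i = sumF2-cong m (λ k → cong (A i k ∧_) (x≗y k))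

matVec-congˡ : ∀ {m} {A C : Mat m} → (∀ i j → A i j ≡ C i j) → ∀ x → matVec A x ≗ matVec C x
matVec-congˡ {m} A≡C x i = sumF2-cong m (λ k → cong (_∧ x k) (A≡C i k))

matVec-zeros : ∀ {m} (A : Mat m) → matVec A zeros ≗ zeros
matVec-zeros {m} A i = sumF2-zeros m (λ k → ∧-zeroʳ (A i k))

matVec-⊕ : ∀ {m} (A : Mat m) (x y : Bits m) → matVec A (x ⊕ y) ≗ matVec A x ⊕ matVec A y
matVec-⊕ {m} A x y i =
  trans (sumF2-cong m (λ k → ∧-distribˡ-xor (A i k) (x k) (y k))) (sumF2-xor m _ _)

matVec-matMul : ∀ {m} (A C : Mat m) (x : Bits m) → matVec (matMul A C) x ≗ matVec A (matVec C x)
matVec-matMul {m} A C x i = begin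
  sumF2 m (λ k → sumF2 m (λ l → A i l ∧ C l k) ∧ x k)
    ≡⟨ sumF2-cong m (λ k → sumF2-∧ʳ m (x k) _) ⟩
  sumF2 m (λ k → sumF2 m (λ l → (A i l ∧ C l k) ∧ x k))
    ≡⟨ sumF2-comm m m _ ⟩
  sumF2 m (λ l → sumF2 m (λ k → (A i l ∧ C l k) ∧ x k))
    ≡⟨ sumF2-cong m factor-out ⟩
  sumF2 m (λ l → A i l ∧ matVec C x l)
    ∎
  where
  open ≡-Reasoning
  factor-out : ∀ l → sumF2 m (λ k → (A i l ∧ C l k) ∧ x k) ≡ A i l ∧ matVec C x l
  factor-out l = trans (sumF2-cong m (λ k → ∧-assoc (A i l) (C l k) (x k))) (sym (sumF2-∧ˡ m (A i l) _))

idMat-diag : ∀ {m} (i : Fin m) → idMat i i ≡ true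
idMat-diag i = Equivalence.to T-≡ (≡⇒≡ᵇ (toℕ i) (toℕ i) refl)

idMat-true⇒≡ : ∀ {m} (i k : Fin m) → idMat i k ≡ true → k ≡ i
idMat-true⇒≡ i k e = toℕ-injective (sym (≡ᵇ⇒≡ (toℕ i) (toℕ k) (Equivalence.from T-≡ e)))

matVec-idMat : ∀ {m} (x : Bits m) → matVec idMat x ≗ x
matVec-idMat {m} x i = sumF2-select m (idMat i) x i (idMat-true⇒≡ i) (idMat-diag i)

toℕ-+-opposite : ∀ {m} (i : Fin m) → toℕ i + toℕ (opposite i) ≡ m ∸ 1
toℕ-+-opposite {suc n} i = trans (cong (toℕ i +_) (opposite-prop i)) (m+[n∸m]≡n (s≤s⁻¹ (toℕ<n i)))

antiDiag-opposite : ∀ {m} (i : Fin m) → antiDiag i (opposite i) ≡ true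
antiDiag-opposite {m} i = Equivalence.to T-≡ (≡⇒≡ᵇ _ (m ∸ 1) (toℕ-+-opposite i))

antiDiag-true⇒opposite : ∀ {m} (i l : Fin m) → antiDiag i l ≡ true → l ≡ opposite i
antiDiag-true⇒opposite {m} i l e = toℕ-injective (+-cancelˡ-≡ (toℕ i) _ _
  (trans (≡ᵇ⇒≡ _ (m ∸ 1) (Equivalence.from T-≡ e)) (sym (toℕ-+-opposite i))))

antiDiag-sym : ∀ {m} (i l : Fin m) → antiDiag i l ≡ antiDiag l i
antiDiag-sym {m} i l = cong (_≡ᵇ (m ∸ 1)) (+-comm (toℕ i) (toℕ l))

matVec-antiDiag : ∀ {m} (x : Bits m) → matVec antiDiag x ≗ x ∘ opposite
matVec-antiDiag {m} x i =
  sumF2-select m (antiDiag i) x (opposite i) (antiDiag-true⇒opposite i) (antiDiag-opposite i)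

matMul-antiDiag : ∀ {m} (A : Mat m) i k → matMul A antiDiag i k ≡ A i (opposite k)
matMul-antiDiag {m} A i k = trans (sumF2-cong m swap) (matVec-antiDiag (A i) k)
  where
  swap : ∀ l → A i l ∧ antiDiag l k ≡ antiDiag k l ∧ A i l
  swap l = trans (∧-comm (A i l) _) (cong (_∧ A i l) (antiDiag-sym l k))

matVec-matMul-antiDiag : ∀ {m} (B : Mat m) x → matVec (matMul B antiDiag) x ≗ matVec B (x ∘ opposite)
matVec-matMul-antiDiag B x i = trans (matVec-matMul B antiDiag x i) (matVec-cong B (matVec-antiDiag x) i)

opposite-<⇒≥ : ∀ {m a b} → a + b ≡ m → (i : Fin m) → toℕ i < a → b ≤ toℕ (opposite i)
opposite-<⇒≥ {m} {a} {b} refl i i<a rewrite opposite-prop i =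
  ≤-trans (≤-reflexive (sym (m+n∸m≡n a b))) (∸-monoʳ-≤ (a + b) i<a)

opposite-≥⇒< : ∀ {m a b} → a + b ≡ m → (i : Fin m) → a ≤ toℕ i → toℕ (opposite i) < b
opposite-≥⇒< {m} {a} {b} refl i a≤i rewrite opposite-prop i =
  ≤-trans (∸-monoʳ-< (s≤s a≤i) (toℕ<n i)) (≤-reflexive (m+n∸m≡n a b))

opposite-reverses-< : ∀ {m} (i j : Fin m) → toℕ i < toℕ j → toℕ (opposite j) < toℕ (opposite i)
opposite-reverses-< i j i<j rewrite opposite-prop i | opposite-prop j = ∸-monoʳ-< (s≤s i<j) (toℕ<n j)

reversed : ∀ {m} → Mat m → Mat m
reversed A i j = A (opposite i) (opposite j)

AgreeBelow : ∀ {m} → ℕ → Bits m → Bits m → Set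
AgreeBelow k x y = ∀ i → toℕ i < k → x i ≡ y i

agreeBelow-mono : ∀ {m j k} {x y : Bits m} → j ≤ k → AgreeBelow k x y → AgreeBelow j x y
agreeBelow-mono j≤k x≈y i i<j = x≈y i (<-≤-trans i<j j≤k)

agreeBelow-suc : ∀ {m k} {x y : Bits m} → AgreeBelow k x y → (∀ i → toℕ i ≡ k → x i ≡ y i) →
  AgreeBelow (suc k) x y
agreeBelow-suc {k = k} below at i i<1+k with m<1+n⇒m<n∨m≡n i<1+k
... | inj₁ i<k = below i i<k
... | inj₂ i≡k = at i i≡k

agreeBelow-opposite⇒≗ : ∀ {m d₀ d₁} {x y : Bits m} → d₀ + d₁ ≡ m →
  AgreeBelow d₀ x y → AgreeBelow d₁ (x ∘ opposite) (y ∘ opposite) → x ≗ y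
agreeBelow-opposite⇒≗ {d₀ = d₀} {x = x} {y} split below above j with toℕ j <? d₀
... | yes j<d₀ = below j j<d₀
... | no  j≮d₀ = subst (λ k → x k ≡ y k) (opposite-involutive j)
                   (above (opposite j) (opposite-≥⇒< split j (≮⇒≥ j≮d₀)))

splice : ∀ {m} → ℕ → Bits m → Bits m → Bits m
splice d x y j with toℕ j <? d
... | yes _ = x j
... | no  _ = y j

splice-agreeBelow : ∀ {m} d (x y : Bits m) → AgreeBelow d (splice d x y) x
splice-agreeBelow d x y j j<d with toℕ j <? d
... | yes _    = refl
... | no  j≮d = ⊥-elim (j≮d j<d)

splice-≥ : ∀ {m} d (x y : Bits m) j → d ≤ toℕ j → splice d x y j ≡ y j
splice-≥ d x y j d≤j with toℕ j <? d
... | yes j<d = ⊥-elim (<⇒≱ j<d d≤j)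
... | no  _   = refl

trailing : ∀ {n} → Mat (suc n) → Mat n
trailing A i j = A (fs i) (fs j)

trailing-unitLower : ∀ {n} {L : Mat (suc n)} → IsUnitLower L → IsUnitLower (trailing L)
trailing-unitLower (upper≡false , diag) = (λ i j i<j → upper≡false (fs i) (fs j) (s≤s i<j)) , diag ∘ fs

module _ {m} {L : Mat m} (unitLower : IsUnitLower L) where

  private
    upper≡false = proj₁ unitLower
    diag = proj₂ unitLower

  unitLower-preserves-agreeBelow : ∀ {k x y} → AgreeBelow k x y →
    AgreeBelow k (matVec L x) (matVec L y)
  unitLower-preserves-agreeBelow {k} {x} {y} x≈y i i<k = sumF2-cong m term
    where
    term : ∀ l → L i l ∧ x l ≡ L i l ∧ y l
    term l with toℕ i <? toℕ l
    ... | yes i<l rewrite upper≡false i l i<l = refl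
    ... | no  i≮l = cong (L i l ∧_) (x≈y l (≤-<-trans (≮⇒≥ i≮l) i<k))

  unitLower-row-⊕ : ∀ {i x y} → AgreeBelow (toℕ i) x y → (matVec L x ⊕ matVec L y) i ≡ (x ⊕ y) i
  unitLower-row-⊕ {i} {x} {y} x≈y = begin
    matVec L x i xor matVec L y i ≡⟨ matVec-⊕ L x y i ⟨
    matVec L (x ⊕ y) i            ≡⟨ sumF2-single m _ i off-diagonal ⟩
    L i i ∧ (x ⊕ y) i             ≡⟨ cong (_∧ (x ⊕ y) i) (diag i) ⟩
    (x ⊕ y) i                     ∎
    where
    open ≡-Reasoning
    off-diagonal : ∀ l → l ≢ i → L i l ∧ (x ⊕ y) l ≡ false
    off-diagonal l l≢i with <-cmp (toℕ l) (toℕ i)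
    ... | tri< l<i _ _ rewrite x≈y l l<i | xor-same (y l) = ∧-zeroʳ (L i l)
    ... | tri≈ _ l≡i _ = ⊥-elim (l≢i (toℕ-injective l≡i))
    ... | tri> _ _ i<l rewrite upper≡false i l i<l = refl

  unitLower-reflects-agreeBelow : ∀ k {x y} → AgreeBelow k (matVec L x) (matVec L y) → AgreeBelow k x y
  unitLower-reflects-agreeBelow zero    _ _ ()
  unitLower-reflects-agreeBelow (suc k) {x} {y} Lx≈Ly = agreeBelow-suc below-k at-k
    where
    open ≡-Reasoning
    below-k = unitLower-reflects-agreeBelow k (agreeBelow-mono (n≤1+n k) Lx≈Ly)
    at-k : ∀ i → toℕ i ≡ k → x i ≡ y i
    at-k i refl = xor≡false⇒≡ (x i) (y i) (begin
      x i xor y i                   ≡⟨ unitLower-row-⊕ below-k ⟨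
      matVec L x i xor matVec L y i ≡⟨ cong (_xor matVec L y i) (Lx≈Ly i ≤-refl) ⟩
      matVec L y i xor matVec L y i ≡⟨ xor-same (matVec L y i) ⟩
      false                         ∎)

unitLower-surjective : ∀ {m} {L : Mat m} → IsUnitLower L → ∀ w → ∃[ x ] matVec L x ≗ w
unitLower-surjective {zero} _ w = zeros , λ ()
unitLower-surjective {suc n} {L} unitLower@(upper≡false , diag) w = x₀ ∷ x′ , Lx≗w
  where
  x₀ = w fz
  rest = unitLower-surjective (trailing-unitLower unitLower) (λ i → w (fs i) xor (L (fs i) fz ∧ x₀))
  x′ = proj₁ rest
  Lx≗w : matVec L (x₀ ∷ x′) ≗ w
  Lx≗w fz rewrite diag fz | sumF2-zeros n (λ k → cong (_∧ x′ k) (upper≡false fz (fs k) (s≤s z≤n))) =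
    xor-identityʳ x₀
  Lx≗w (fs i) rewrite proj₂ rest i | xor-comm (w (fs i)) (L (fs i) fz ∧ x₀) =
    xor-cancelˡ (L (fs i) fz ∧ x₀) (w (fs i))

IsUnitUpper : ∀ {m} → Mat m → Set
IsUnitUpper {m} U =
  (∀ (i j : Fin m) → toℕ j < toℕ i → U i j ≡ false) × (∀ (i : Fin m) → U i i ≡ true)

reversed-unitUpper : ∀ {m} {U : Mat m} → IsUnitUpper U → IsUnitLower (reversed U)
reversed-unitUpper (lower≡false , diag) =
  (λ i j i<j → lower≡false (opposite i) (opposite j) (opposite-reverses-< i j i<j)) , diag ∘ opposite

-- LU decomposition

SupportedBelow : ∀ {m} → ℕ → Bits m → Set
SupportedBelow k x = ∀ j → k ≤ toℕ j → x j ≡ false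

-- Kernel form of "every leading principal k × k submatrix of M is nonsingular".
LeadingMinorsNonsingular : ∀ {m} → Mat m → Set
LeadingMinorsNonsingular {m} M =
  ∀ k → k ≤ m → ∀ x → SupportedBelow k x → AgreeBelow k (matVec M x) zeros → x ≗ zeros

HasLU : ∀ {m} → Mat m → Set
HasLU M = ∃[ L ] ∃[ U ] (IsUnitLower L × IsUnitUpper U × (∀ i j → M i j ≡ matMul L U i j))

bordered : ∀ {n} → F2 → Bits n → Bits n → Mat n → Mat (suc n)
bordered a r c A fz     fz     = a
bordered a r c A fz     (fs j) = r j
bordered a r c A (fs i) fz     = c i
bordered a r c A (fs i) (fs j) = A i j

bordered-unitLower : ∀ {n} (c : Bits n) {L : Mat n} → IsUnitLower L → IsUnitLower (bordered true zeros c L)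
bordered-unitLower c (upper≡false , diag) = upper , diag′
  where
  upper : ∀ i j → toℕ i < toℕ j → bordered true zeros c _ i j ≡ false
  upper fz     (fs j) _   = refl
  upper (fs i) (fs j) i<j = upper≡false i j (s≤s⁻¹ i<j)
  diag′ : ∀ i → bordered true zeros c _ i i ≡ true
  diag′ fz     = refl
  diag′ (fs i) = diag i

bordered-unitUpper : ∀ {n} (r : Bits n) {U : Mat n} → IsUnitUpper U → IsUnitUpper (bordered true r zeros U)
bordered-unitUpper r (lower≡false , diag) = lower , diag′
  where
  lower : ∀ i j → toℕ j < toℕ i → bordered true r zeros _ i j ≡ false
  lower (fs i) fz     _   = refl
  lower (fs i) (fs j) j<i = lower≡false i j (s≤s⁻¹ j<i)
  diag′ : ∀ i → bordered true r zeros _ i i ≡ true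
  diag′ fz     = refl
  diag′ (fs i) = diag i

-- Schur complement of the pivot M 0 0, which is 1 wherever this is used.
schur : ∀ {n} → Mat (suc n) → Mat n
schur M i j = M (fs i) (fs j) xor (M (fs i) fz ∧ M fz (fs j))

schur-inverse : ∀ {n} (M : Mat (suc n)) i j → M (fs i) (fs j) ≡ (M (fs i) fz ∧ M fz (fs j)) xor schur M i j
schur-inverse M i j = sym (trans (cong (a xor_) (xor-comm (M (fs i) (fs j)) a)) (xor-cancelˡ a (M (fs i) (fs j))))
  where a = M (fs i) fz ∧ M fz (fs j)

module _ {n} {M : Mat (suc n)} (nonsingular : LeadingMinorsNonsingular M) where

  pivot : M fz fz ≡ true
  pivot with M fz fz in M₀₀
  ... | true  = refl
  ... | false = contradiction (nonsingular 1 (s≤s z≤n) e₀ e₀-supported Me₀≈0 fz) λ ()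
    where
    e₀ = true ∷ zeros
    e₀-supported : SupportedBelow 1 e₀
    e₀-supported (fs j) _ = refl
    Me₀≈0 : AgreeBelow 1 (matVec M e₀) zeros
    Me₀≈0 fz _ rewrite M₀₀ = sumF2-zeros n (λ k → ∧-zeroʳ (M fz (fs k)))
    Me₀≈0 (fs i) (s≤s ())

  matVec-schur : ∀ x′ i →
    matVec M (sumF2 n (λ j → M fz (fs j) ∧ x′ j) ∷ x′) (fs i) ≡ matVec (schur M) x′ i
  matVec-schur x′ i = begin
    c ∧ sumF2 n r·x′ xor sumF2 n M′x′          ≡⟨ xor-comm (c ∧ sumF2 n r·x′) _ ⟩
    sumF2 n M′x′ xor c ∧ sumF2 n r·x′          ≡⟨ cong (sumF2 n M′x′ xor_) (sumF2-∧ˡ n c r·x′) ⟩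
    sumF2 n M′x′ xor sumF2 n (λ j → c ∧ r·x′ j) ≡⟨ sumF2-xor n M′x′ _ ⟨
    sumF2 n (λ j → M′x′ j xor c ∧ r·x′ j)      ≡⟨ sumF2-cong n entry ⟩
    matVec (schur M) x′ i                      ∎
    where
    open ≡-Reasoning
    c = M (fs i) fz
    r·x′ = λ j → M fz (fs j) ∧ x′ j
    M′x′ = λ j → M (fs i) (fs j) ∧ x′ j
    entry : ∀ j → M′x′ j xor c ∧ r·x′ j ≡ schur M i j ∧ x′ j
    entry j = trans (cong (M′x′ j xor_) (sym (∧-assoc c (M fz (fs j)) (x′ j))))
                    (sym (∧-distribʳ-xor (x′ j) (M (fs i) (fs j)) (c ∧ M fz (fs j))))

  schur-nonsingular : LeadingMinorsNonsingular (schur M)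
  schur-nonsingular k k≤n x′ x′-supported Sx′≈0 j = x≗0 (fs j)
    where
    -- x₀ makes row 0 of M (x₀ ∷ x′) vanish, and the other rows are those of schur M x′.
    x₀ = sumF2 n (λ j → M fz (fs j) ∧ x′ j)
    x-supported : SupportedBelow (suc k) (x₀ ∷ x′)
    x-supported (fs j) 1+k≤1+j = x′-supported j (s≤s⁻¹ 1+k≤1+j)
    Mx≈0 : AgreeBelow (suc k) (matVec M (x₀ ∷ x′)) zeros
    Mx≈0 fz     _       rewrite pivot = xor-same x₀
    Mx≈0 (fs i) 1+i<1+k = trans (matVec-schur x′ i) (Sx′≈0 i (s≤s⁻¹ 1+i<1+k))
    x≗0 = nonsingular (suc k) (s≤s k≤n) (x₀ ∷ x′) x-supported Mx≈0

lu-decomposition : ∀ {m} (M : Mat m) → LeadingMinorsNonsingular M → HasLU M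
lu-decomposition {zero} M _ = M , M , ((λ ()) , (λ ())) , ((λ ()) , (λ ())) , λ ()
lu-decomposition {suc n} M nonsingular
  with lu-decomposition (schur M) (schur-nonsingular {M = M} nonsingular)
... | L , U , unitLower , unitUpper , S≡LU =
  bordered true zeros c L , bordered true r zeros U ,
  bordered-unitLower c unitLower , bordered-unitUpper r unitUpper , M≡LU
  where
  r = λ j → M fz (fs j)
  c = λ i → M (fs i) fz
  M≡LU : ∀ i j → M i j ≡ matMul (bordered true zeros c L) (bordered true r zeros U) i j
  M≡LU fz     fz     = trans (pivot {M = M} nonsingular) (cong (true xor_) (sym (sumF2-false n)))
  M≡LU fz     (fs j) = sym (trans (cong (r j xor_) (sumF2-false n)) (xor-identityʳ (r j)))
  M≡LU (fs i) fz     = sym (begin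
    c i ∧ true xor sumF2 n (λ k → L i k ∧ false)
      ≡⟨ cong₂ _xor_ (∧-identityʳ (c i)) (sumF2-zeros n (∧-zeroʳ ∘ L i)) ⟩
    c i xor false
      ≡⟨ xor-identityʳ (c i) ⟩
    c i ∎)
    where open ≡-Reasoning
  M≡LU (fs i) (fs j) = trans (schur-inverse M i j) (cong (c i ∧ r j xor_) (S≡LU i j))

-- Factorizations B = L₁JL₂

HasLJL : ∀ {m} → Mat m → Set
HasLJL B = ∃[ L₁ ] ∃[ L₂ ] (IsUnitLower L₁ × IsUnitLower L₂ ×
  (∀ i j → B i j ≡ matMul (matMul L₁ antiDiag) L₂ i j))

-- The map x ↦ (x|d₀ , (Bx)|d₁) whose fibres are the elementary boxes of the net (I, B).
PrefixMapsInjective : ∀ {m} → Mat m → Set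
PrefixMapsInjective {m} B = ∀ d₀ d₁ → d₀ + d₁ ≡ m → ∀ x y →
  AgreeBelow d₀ x y → AgreeBelow d₁ (matVec B x) (matVec B y) → x ≗ y

PrefixMapsSurjective : ∀ {m} → Mat m → Set
PrefixMapsSurjective {m} B = ∀ d₀ d₁ → d₀ + d₁ ≡ m → ∀ u v →
  ∃[ x ] (AgreeBelow d₀ x u × AgreeBelow d₁ (matVec B x) v)

prefixMapsInjective⇒leadingMinorsNonsingular : ∀ {m} {B : Mat m} →
  PrefixMapsInjective B → LeadingMinorsNonsingular (matMul B antiDiag)
prefixMapsInjective⇒leadingMinorsNonsingular {m} {B} injective k k≤m x x-supported BJx≈0 j =
  subst (λ i → x i ≡ false) (opposite-involutive j) (x∘opposite≗0 (opposite j))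
  where
  split : m ∸ k + k ≡ m
  split = m∸n+n≡m k≤m
  x∘opposite≗0 : x ∘ opposite ≗ zeros
  x∘opposite≗0 = injective (m ∸ k) k split (x ∘ opposite) zeros
    (λ i i<m∸k → x-supported (opposite i) (opposite-<⇒≥ split i i<m∸k))
    (λ i i<k → trans (sym (matVec-matMul-antiDiag B x i)) (trans (BJx≈0 i i<k) (sym (matVec-zeros B i))))

prefixMapsInjective⇒hasLJL : ∀ {m} {B : Mat m} → PrefixMapsInjective B → HasLJL B
prefixMapsInjective⇒hasLJL {m} {B} injective
  with lu-decomposition (matMul B antiDiag) (prefixMapsInjective⇒leadingMinorsNonsingular injective)
... | L , U , unitLower , unitUpper , BJ≡LU = L , reversed U , unitLower , reversed-unitUpper unitUpper , B≡LJL
  where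
  -- B = (BJ)J = LUJ = LJ(JUJ).
  B≡LJL : ∀ i j → B i j ≡ matMul (matMul L antiDiag) (reversed U) i j
  B≡LJL i j = sym (begin
    sumF2 m (λ k → matMul L antiDiag i k ∧ U (opposite k) (opposite j))
      ≡⟨ sumF2-cong m (λ k → cong (_∧ U (opposite k) (opposite j)) (matMul-antiDiag L i k)) ⟩
    sumF2 m (λ k → L i (opposite k) ∧ U (opposite k) (opposite j))
      ≡⟨ sumF2-opposite m (λ k → L i k ∧ U k (opposite j)) ⟩
    matMul L U i (opposite j)          ≡⟨ BJ≡LU i (opposite j) ⟨
    matMul B antiDiag i (opposite j)   ≡⟨ matMul-antiDiag B i (opposite j) ⟩
    B i (opposite (opposite j))        ≡⟨ cong (B i) (opposite-involutive j) ⟩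
    B i j                              ∎)
    where open ≡-Reasoning

module _ {m} {B L₁ L₂ : Mat m} (unitLower₁ : IsUnitLower L₁) (unitLower₂ : IsUnitLower L₂)
         (B≡L₁JL₂ : ∀ i j → B i j ≡ matMul (matMul L₁ antiDiag) L₂ i j) where

  matVec-LJL : ∀ x → matVec B x ≗ matVec L₁ (matVec L₂ x ∘ opposite)
  matVec-LJL x i = begin
    matVec B x i                                  ≡⟨ matVec-congˡ B≡L₁JL₂ x i ⟩
    matVec (matMul (matMul L₁ antiDiag) L₂) x i   ≡⟨ matVec-matMul (matMul L₁ antiDiag) L₂ x i ⟩
    matVec (matMul L₁ antiDiag) (matVec L₂ x) i   ≡⟨ matVec-matMul-antiDiag L₁ (matVec L₂ x) i ⟩
    matVec L₁ (matVec L₂ x ∘ opposite) i          ∎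
    where open ≡-Reasoning

  factored⇒prefixMapsInjective : PrefixMapsInjective B
  factored⇒prefixMapsInjective d₀ d₁ split x y x≈y Bx≈By j =
    unitLower-reflects-agreeBelow unitLower₂ m (λ i _ → L₂x≗L₂y i) j (toℕ<n j)
    where
    L₂x≗L₂y : matVec L₂ x ≗ matVec L₂ y
    L₂x≗L₂y = agreeBelow-opposite⇒≗ split
      (unitLower-preserves-agreeBelow unitLower₂ x≈y)
      (unitLower-reflects-agreeBelow unitLower₁ d₁ λ i i<d₁ →
         trans (sym (matVec-LJL x i)) (trans (Bx≈By i i<d₁) (matVec-LJL y i)))

  factored⇒prefixMapsSurjective : PrefixMapsSurjective B
  factored⇒prefixMapsSurjective d₀ d₁ split u v = x , x≈u , Bx≈v
    where
    -- w = L₂ x takes its first d₀ entries from L₂ u and its last d₁ entries from L₁⁻¹ v.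
    z = unitLower-surjective unitLower₁ v
    w = splice d₀ (matVec L₂ u) (proj₁ z ∘ opposite)
    x-solves = unitLower-surjective unitLower₂ w
    x = proj₁ x-solves
    x≈u : AgreeBelow d₀ x u
    x≈u = unitLower-reflects-agreeBelow unitLower₂ d₀ λ i i<d₀ →
      trans (proj₂ x-solves i) (splice-agreeBelow d₀ _ _ i i<d₀)
    w∘opposite≈z : AgreeBelow d₁ (w ∘ opposite) (proj₁ z)
    w∘opposite≈z i i<d₁ =
      trans (splice-≥ d₀ _ _ (opposite i) (opposite-<⇒≥ (trans (+-comm d₁ d₀) split) i i<d₁))
            (cong (proj₁ z) (opposite-involutive i))
    Bx≈v : AgreeBelow d₁ (matVec B x) v
    Bx≈v i i<d₁ = begin
      matVec B x i                         ≡⟨ matVec-LJL x i ⟩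
      matVec L₁ (matVec L₂ x ∘ opposite) i ≡⟨ matVec-cong L₁ (proj₂ x-solves ∘ opposite) i ⟩
      matVec L₁ (w ∘ opposite) i           ≡⟨ unitLower-preserves-agreeBelow unitLower₁ w∘opposite≈z i i<d₁ ⟩
      matVec L₁ (proj₁ z) i                ≡⟨ proj₂ z i ⟩
      v i                                  ∎
      where open ≡-Reasoning

-- Binary expansions

bit : F2 → ℕ → ℕ
bit b k = if b then 2 ^ k else 0

bit≤2^ : ∀ b k → bit b k ≤ 2 ^ k
bit≤2^ true  k = ≤-refl
bit≤2^ false k = z≤n

bit+<2^suc : ∀ b k {r} → r < 2 ^ k → bit b k + r < 2 ^ suc k
bit+<2^suc b k r<2^k =
  ≤-trans (+-mono-≤-< (bit≤2^ b k) r<2^k) (≤-reflexive (cong (2 ^ k +_) (sym (+-identityʳ (2 ^ k)))))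

bit+-injective : ∀ b b′ k {r r′} → r < 2 ^ k → r′ < 2 ^ k →
  bit b k + r ≡ bit b′ k + r′ → b ≡ b′ × r ≡ r′
bit+-injective true  true  k _ _ e = refl , +-cancelˡ-≡ (2 ^ k) _ _ e
bit+-injective false false k _ _ e = refl , e
bit+-injective true  false k {r} _ r′<2^k e =
  ⊥-elim (<⇒≱ r′<2^k (≤-trans (m≤m+n (2 ^ k) r) (≤-reflexive e)))
bit+-injective false true  k {r′ = r′} r<2^k _ e =
  ⊥-elim (<⇒≱ r<2^k (≤-trans (m≤m+n (2 ^ k) r′) (≤-reflexive (sym e))))

bit-*2^ : ∀ b d e → bit b (d + e) ≡ bit b d * 2 ^ e
bit-*2^ true  d e = ^-distribˡ-+-* 2 d e
bit-*2^ false d e = refl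

-- Inverse of Defs' digits, which is little-endian, unlike phiNum.
fromDigits : ∀ m → Bits m → ℕ
fromDigits zero    v = 0
fromDigits (suc n) v = bit (v fz) 0 + fromDigits n (v ∘ fs) * 2

fromDigits<2^m : ∀ m (v : Bits m) → fromDigits m v < 2 ^ m
fromDigits<2^m zero    v = s≤s z≤n
fromDigits<2^m (suc n) v = begin-strict
  bit (v fz) 0 + k * 2 ≤⟨ +-monoˡ-≤ (k * 2) (bit≤2^ (v fz) 0) ⟩
  1 + k * 2            <⟨ n<1+n (1 + k * 2) ⟩
  suc k * 2            ≤⟨ *-monoˡ-≤ 2 (fromDigits<2^m n (v ∘ fs)) ⟩
  2 ^ n * 2            ≡⟨ *-comm (2 ^ n) 2 ⟩
  2 ^ suc n            ∎
  where
  open ≤-Reasoning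
  k = fromDigits n (v ∘ fs)

fromDigits-cong : ∀ m {v w : Bits m} → v ≗ w → fromDigits m v ≡ fromDigits m w
fromDigits-cong zero    v≗w = refl
fromDigits-cong (suc n) v≗w = cong₂ (λ b k → bit b 0 + k * 2) (v≗w fz) (fromDigits-cong n (v≗w ∘ fs))

digits-fromDigits : ∀ m (v : Bits m) → digits m (fromDigits m v) ≗ v
digits-fromDigits (suc n) v fz     = trans (cong (_≡ᵇ 1) ([m+kn]%n≡m%n (bit (v fz) 0) k 2)) (parity (v fz))
  where
  k = fromDigits n (v ∘ fs)
  parity : ∀ b → (bit b 0 % 2 ≡ᵇ 1) ≡ b
  parity true  = refl
  parity false = refl
digits-fromDigits (suc n) v (fs i) = begin
  digit ((bit (v fz) 0 + k * 2) / 2) (toℕ i) ≡⟨ cong (λ l → digit l (toℕ i)) half ⟩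
  digit k (toℕ i)                            ≡⟨ digits-fromDigits n (v ∘ fs) i ⟩
  v (fs i)                                   ∎
  where
  open ≡-Reasoning
  k = fromDigits n (v ∘ fs)
  half : (bit (v fz) 0 + k * 2) / 2 ≡ k
  half = trans (+-distrib-/-∣ʳ (bit (v fz) 0) (n∣m*n k))
               (cong₂ _+_ (m<n⇒m/n≡0 (s≤s (bit≤2^ (v fz) 0))) (m*n/n≡m k 2))

fromDigits-digits : ∀ m l → l < 2 ^ m → fromDigits m (digits m l) ≡ l
fromDigits-digits zero    zero    _ = refl
fromDigits-digits zero    (suc l) (s≤s ())
fromDigits-digits (suc n) l l<2^m = begin
  bit (l % 2 ≡ᵇ 1) 0 + fromDigits n (digits n (l / 2)) * 2
    ≡⟨ cong₂ (λ r q → r + q * 2) (low-bit (m%n<n l 2)) IH ⟩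
  l % 2 + l / 2 * 2
    ≡⟨ m≡m%n+[m/n]*n l 2 ⟨
  l ∎
  where
  open ≡-Reasoning
  IH = fromDigits-digits n (l / 2) (m<n*o⇒m/o<n (≤-trans l<2^m (≤-reflexive (*-comm 2 (2 ^ n)))))
  low-bit : ∀ {r} → r < 2 → bit (r ≡ᵇ 1) 0 ≡ r
  low-bit {0} _ = refl
  low-bit {1} _ = refl
  low-bit {suc (suc r)} (s≤s (s≤s ()))

-- ⌊2^d φ(y)⌋, the number with binary digits y 0, …, y (d - 1).
prefixValue : ∀ m → ℕ → Bits m → ℕ
prefixValue zero    d       y = 0
prefixValue (suc n) zero    y = 0
prefixValue (suc n) (suc d) y = bit (y fz) d + prefixValue n d (y ∘ fs)

prefixValue<2^d : ∀ m d (y : Bits m) → prefixValue m d y < 2 ^ d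
prefixValue<2^d zero    d       y = m^n>0 2 d
prefixValue<2^d (suc n) zero    y = s≤s z≤n
prefixValue<2^d (suc n) (suc d) y = bit+<2^suc (y fz) d (prefixValue<2^d n d (y ∘ fs))

prefixValue-cong : ∀ m d {y y′ : Bits m} → AgreeBelow d y y′ → prefixValue m d y ≡ prefixValue m d y′
prefixValue-cong zero    d       _    = refl
prefixValue-cong (suc n) zero    _    = refl
prefixValue-cong (suc n) (suc d) y≈y′ =
  cong₂ (λ b r → bit b d + r) (y≈y′ fz (s≤s z≤n))
        (prefixValue-cong n d (λ i i<d → y≈y′ (fs i) (s≤s i<d)))

prefixValue-injective : ∀ m d {y y′ : Bits m} →
  prefixValue m d y ≡ prefixValue m d y′ → AgreeBelow d y y′
prefixValue-injective (suc n) (suc d) {y} {y′} e fz     _         = proj₁ heads-tails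
  where heads-tails = bit+-injective (y fz) (y′ fz) d (prefixValue<2^d n d _) (prefixValue<2^d n d _) e
prefixValue-injective (suc n) (suc d) {y} {y′} e (fs i) (s≤s i<d) =
  prefixValue-injective n d (proj₂ heads-tails) i i<d
  where heads-tails = bit+-injective (y fz) (y′ fz) d (prefixValue<2^d n d _) (prefixValue<2^d n d _) e

prefixValue-surjective : ∀ m d a → d ≤ m → a < 2 ^ d → ∃[ y ] prefixValue m d y ≡ a
prefixValue-surjective zero    zero    zero    _ _ = zeros , refl
prefixValue-surjective zero    zero    (suc a) _ (s≤s ())
prefixValue-surjective (suc n) zero    zero    _ _ = zeros , refl
prefixValue-surjective (suc n) zero    (suc a) _ (s≤s ())
prefixValue-surjective (suc n) (suc d) a (s≤s d≤n) a<2^[1+d] with 2 ^ d ≤? a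
... | yes 2^d≤a = true ∷ proj₁ rest , trans (cong (2 ^ d +_) (proj₂ rest)) (m+[n∸m]≡n 2^d≤a)
  where
  a∸2^d<2^d : a ∸ 2 ^ d < 2 ^ d
  a∸2^d<2^d = +-cancelˡ-< (2 ^ d) _ _ (begin-strict
    2 ^ d + (a ∸ 2 ^ d) ≡⟨ m+[n∸m]≡n 2^d≤a ⟩
    a                   <⟨ a<2^[1+d] ⟩
    2 * 2 ^ d           ≡⟨ cong (2 ^ d +_) (+-identityʳ (2 ^ d)) ⟩
    2 ^ d + 2 ^ d       ∎)
    where open ≤-Reasoning
  rest = prefixValue-surjective n d (a ∸ 2 ^ d) d≤n a∸2^d<2^d
... | no  2^d≰a = false ∷ proj₁ rest , proj₂ rest
  where rest = prefixValue-surjective n d a d≤n (≰⇒> 2^d≰a)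

phiNum<2^m : ∀ m (y : Bits m) → phiNum m y < 2 ^ m
phiNum<2^m zero    y = s≤s z≤n
phiNum<2^m (suc n) y = bit+<2^suc (y fz) n (phiNum<2^m n (y ∘ fs))

phiNum/2^[m∸d]≡prefixValue : ∀ m d (y : Bits m) → d ≤ m → .{{_ : NonZero (2 ^ (m ∸ d))}} →
  phiNum m y / 2 ^ (m ∸ d) ≡ prefixValue m d y
phiNum/2^[m∸d]≡prefixValue zero    zero    y _ = refl
phiNum/2^[m∸d]≡prefixValue (suc n) zero    y _ = m<n⇒m/n≡0 (phiNum<2^m (suc n) y)
phiNum/2^[m∸d]≡prefixValue (suc n) (suc d) y (s≤s d≤n) = begin
  (bit (y fz) n + R) / Q             ≡⟨ cong (λ k → (k + R) / Q) leading ⟩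
  (bit (y fz) d * Q + R) / Q         ≡⟨ +-distrib-/-∣ˡ R (n∣m*n (bit (y fz) d)) ⟩
  bit (y fz) d * Q / Q + R / Q
    ≡⟨ cong₂ _+_ (m*n/n≡m (bit (y fz) d) Q) (phiNum/2^[m∸d]≡prefixValue n d (y ∘ fs) d≤n) ⟩
  bit (y fz) d + prefixValue n d (y ∘ fs) ∎
  where
  open ≡-Reasoning
  Q = 2 ^ (n ∸ d)
  R = phiNum n (y ∘ fs)
  leading : bit (y fz) n ≡ bit (y fz) d * Q
  leading = trans (cong (bit (y fz)) (sym (m+[n∸m]≡n d≤n))) (bit-*2^ (y fz) d (n ∸ d))

inInterval⇔/ : ∀ m d a N .{{_ : NonZero (2 ^ (m ∸ d))}} →
  inInterval m d a N ≡ true ⇔ N / 2 ^ (m ∸ d) ≡ a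
inInterval⇔/ m d a N = mk⇔ to from
  where
  Q = 2 ^ (m ∸ d)
  to : inInterval m d a N ≡ true → N / Q ≡ a
  to e = ≤-antisym (m<1+n⇒m≤n (m<n*o⇒m/o<n N<[1+a]Q))
                   (≤-trans (≤-reflexive (sym (m*n/n≡m a Q))) (/-monoˡ-≤ Q aQ≤N))
    where
    bounds = Equivalence.to T-∧ (Equivalence.from T-≡ e)
    aQ≤N = ≤ᵇ⇒≤ (a * Q) N (proj₁ bounds)
    N<[1+a]Q = <ᵇ⇒< N (suc a * Q) (proj₂ bounds)
  from : N / Q ≡ a → inInterval m d a N ≡ true
  from refl = Equivalence.to T-≡ (Equivalence.from T-∧ (≤⇒≤ᵇ (m/n*n≤m N Q) , <⇒<ᵇ N<[1+N/Q]Q))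
    where
    N<[1+N/Q]Q : N < suc (N / Q) * Q
    N<[1+N/Q]Q = begin-strict
      N                 ≡⟨ m≡m%n+[m/n]*n N Q ⟩
      N % Q + N / Q * Q <⟨ +-monoˡ-< (N / Q * Q) (m%n<n N Q) ⟩
      Q + N / Q * Q     ∎
      where open ≤-Reasoning

inInterval-phiNum⇔ : ∀ m d a (y : Bits m) → d ≤ m →
  inInterval m d a (phiNum m y) ≡ true ⇔ prefixValue m d y ≡ a
inInterval-phiNum⇔ m d a y d≤m =
  mk⇔ (λ e → trans (sym value) (Equivalence.to interval e))
      (λ e → Equivalence.from interval (trans value e))
  where
  instance
    2^[m∸d]-nonZero : NonZero (2 ^ (m ∸ d))
    2^[m∸d]-nonZero = m^n≢0 2 (m ∸ d)
  interval = inInterval⇔/ m d a (phiNum m y)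
  value = phiNum/2^[m∸d]≡prefixValue m d y d≤m

module _ (P : ℕ → Bool) where

  count≡0⇒false : ∀ n {l} → count P n ≡ 0 → l < n → P l ≡ false
  count≡0⇒false (suc n) {l} c≡0 l<1+n with P n in Pn | m<1+n⇒m<n∨m≡n l<1+n
  ... | false | inj₁ l<n  = count≡0⇒false n c≡0 l<n
  ... | false | inj₂ refl = Pn
  ... | true  | _ with () ← c≡0

  false⇒count≡0 : ∀ n → (∀ l → l < n → P l ≡ false) → count P n ≡ 0
  false⇒count≡0 zero    _     = refl
  false⇒count≡0 (suc n) allFalse rewrite allFalse n ≤-refl =
    false⇒count≡0 n (λ l l<n → allFalse l (m<n⇒m<1+n l<n))

  <1+n⇒<n : ∀ {n l} → l < suc n → P l ≡ true → P n ≡ false → l < n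
  <1+n⇒<n l<1+n Pl Pn with m<1+n⇒m<n∨m≡n l<1+n
  ... | inj₁ l<n  = l<n
  ... | inj₂ refl with () ← trans (sym Pl) Pn

  count≡1 : ∀ n {w} → w < n → P w ≡ true → (∀ l → l < n → P l ≡ true → l ≡ w) →
    count P n ≡ 1
  count≡1 (suc n) {w} w<1+n Pw unique with P n in Pn
  ... | true  = cong suc (false⇒count≡0 n others)
    where
    others : ∀ l → l < n → P l ≡ false
    others l l<n with P l in Pl
    ... | false = refl
    ... | true  = ⊥-elim (<-irrefl (trans (unique l (m<n⇒m<1+n l<n) Pl) (sym (unique n ≤-refl Pn))) l<n)
  ... | false = count≡1 n (<1+n⇒<n w<1+n Pw Pn) Pw (λ l l<n → unique l (m<n⇒m<1+n l<n))

  count≡1⇒unique : ∀ n {l l′} → count P n ≡ 1 →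
    l < n → l′ < n → P l ≡ true → P l′ ≡ true → l ≡ l′
  count≡1⇒unique (suc n) {l} {l′} c≡1 l<1+n l′<1+n Pl Pl′ with P n in Pn
  ... | true  = trans (last l<1+n Pl) (sym (last l′<1+n Pl′))
    where
    last : ∀ {k} → k < suc n → P k ≡ true → k ≡ n
    last {k} k<1+n Pk with m<1+n⇒m<n∨m≡n k<1+n
    ... | inj₂ k≡n = k≡n
    ... | inj₁ k<n with () ← trans (sym Pk) (count≡0⇒false n (suc-injective c≡1) k<n)
  ... | false = count≡1⇒unique n c≡1 (<1+n⇒<n l<1+n Pl Pn) (<1+n⇒<n l′<1+n Pl′ Pn) Pl Pl′

-- The digital net generated by (I, B)

module _ {m} (B : Mat m) where

  InBox : (Fin 2 → ℕ) → (Fin 2 → ℕ) → ℕ → Bool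
  InBox d a l = allB 2 (λ i → inInterval m (d i) (a i) (netCoord m 2 (pair idMat B) l i))

  inBox⇔ : ∀ d a → d fz + d (fs fz) ≡ m → ∀ l {x} → digits m l ≗ x →
    InBox d a l ≡ true ⇔
      (prefixValue m (d fz) x ≡ a fz × prefixValue m (d (fs fz)) (matVec B x) ≡ a (fs fz))
  inBox⇔ d a split l {x} l≗x = mk⇔
    (λ e → to₀ (∧-conicalˡ I₀ (I₁ ∧ true) e) ,
           to₁ (∧-conicalˡ I₁ true (∧-conicalʳ I₀ (I₁ ∧ true) e)))
    (λ (e₀ , e₁) → cong₂ _∧_ (from₀ e₀) (cong (_∧ true) (from₁ e₁)))
    where
    d₀ = d fz
    d₁ = d (fs fz)
    I₀ = inInterval m d₀ (a fz) (phiNum m (matVec idMat (digits m l)))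
    I₁ = inInterval m d₁ (a (fs fz)) (phiNum m (matVec B (digits m l)))
    first = inInterval-phiNum⇔ m d₀ (a fz) (matVec idMat (digits m l)) (m+n≤o⇒m≤o d₀ (≤-reflexive split))
    second = inInterval-phiNum⇔ m d₁ (a (fs fz)) (matVec B (digits m l)) (m+n≤o⇒n≤o d₀ (≤-reflexive split))
    value₀ : prefixValue m d₀ (matVec idMat (digits m l)) ≡ prefixValue m d₀ x
    value₀ = prefixValue-cong m d₀ (λ i _ → trans (matVec-idMat (digits m l) i) (l≗x i))
    value₁ : prefixValue m d₁ (matVec B (digits m l)) ≡ prefixValue m d₁ (matVec B x)
    value₁ = prefixValue-cong m d₁ (λ i _ → matVec-cong B l≗x i)
    to₀ = λ e → trans (sym value₀) (Equivalence.to first e)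
    to₁ = λ e → trans (sym value₁) (Equivalence.to second e)
    from₀ = λ e → Equivalence.from first (trans value₀ e)
    from₁ = λ e → Equivalence.from second (trans value₁ e)

  isNet⇒prefixMapsInjective : IsNet m 2 (pair idMat B) 0 → PrefixMapsInjective B
  isNet⇒prefixMapsInjective (_ , equidistributed) d₀ d₁ split x y x≈y Bx≈By i = begin
    x i                         ≡⟨ digits-fromDigits m x i ⟨
    digits m (fromDigits m x) i ≡⟨ cong (λ l → digits m l i) same-index ⟩
    digits m (fromDigits m y) i ≡⟨ digits-fromDigits m y i ⟩
    y i                         ∎
    where
    open ≡-Reasoning
    d = d₀ ∷ d₁ ∷ []
    a = prefixValue m d₀ x ∷ prefixValue m d₁ (matVec B x) ∷ []
    a<2^d : ∀ j → a j < 2 ^ d j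
    a<2^d fz      = prefixValue<2^d m d₀ x
    a<2^d (fs fz) = prefixValue<2^d m d₁ (matVec B x)
    one-point = equidistributed d (trans (cong (d₀ +_) (+-identityʳ d₁)) split) a a<2^d
    x-inBox = Equivalence.from (inBox⇔ d a split (fromDigits m x) (digits-fromDigits m x)) (refl , refl)
    y-inBox = Equivalence.from (inBox⇔ d a split (fromDigits m y) (digits-fromDigits m y))
      (sym (prefixValue-cong m d₀ x≈y) , sym (prefixValue-cong m d₁ Bx≈By))
    same-index = count≡1⇒unique (InBox d a) (2 ^ m) one-point
      (fromDigits<2^m m x) (fromDigits<2^m m y) x-inBox y-inBox

  prefixMapsBijective⇒isNet : PrefixMapsInjective B → PrefixMapsSurjective B →
    IsNet m 2 (pair idMat B) 0
  prefixMapsBijective⇒isNet injective surjective = z≤n , equidistributed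
    where
    equidistributed : ∀ d → sumℕ 2 d ≡ m → ∀ a → (∀ i → a i < 2 ^ d i) →
      count (InBox d a) (2 ^ m) ≡ 1
    equidistributed d sum≡m a a<2^d = count≡1 (InBox d a) (2 ^ m) (fromDigits<2^m m x) x-inBox unique
      where
      d₀ = d fz
      d₁ = d (fs fz)
      split : d₀ + d₁ ≡ m
      split = trans (cong (d₀ +_) (sym (+-identityʳ d₁))) sum≡m
      u = prefixValue-surjective m d₀ (a fz) (m+n≤o⇒m≤o d₀ (≤-reflexive split)) (a<2^d fz)
      v = prefixValue-surjective m d₁ (a (fs fz)) (m+n≤o⇒n≤o d₀ (≤-reflexive split)) (a<2^d (fs fz))
      solution = surjective d₀ d₁ split (proj₁ u) (proj₁ v)
      x = proj₁ solution
      x-value₀ : prefixValue m d₀ x ≡ a fz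
      x-value₀ = trans (prefixValue-cong m d₀ (proj₁ (proj₂ solution))) (proj₂ u)
      x-value₁ : prefixValue m d₁ (matVec B x) ≡ a (fs fz)
      x-value₁ = trans (prefixValue-cong m d₁ (proj₂ (proj₂ solution))) (proj₂ v)
      x-inBox = Equivalence.from (inBox⇔ d a split (fromDigits m x) (digits-fromDigits m x))
                                 (x-value₀ , x-value₁)
      unique : ∀ l → l < 2 ^ m → InBox d a l ≡ true → l ≡ fromDigits m x
      unique l l<2^m l-inBox = trans (sym (fromDigits-digits m l l<2^m)) (fromDigits-cong m digits≗x)
        where
        values = Equivalence.to (inBox⇔ d a split l (λ _ → refl)) l-inBox
        digits≗x = injective d₀ d₁ split (digits m l) x
          (prefixValue-injective m d₀ (trans (proj₁ values) (sym x-value₀)))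
          (prefixValue-injective m d₁ (trans (proj₂ values) (sym x-value₁)))

lemma8 : ∀ (m : ℕ) (B : Mat m) →
    HasTValue m 2 (pair idMat B) 0
      ⇔ (∃[ L₁ ] ∃[ L₂ ] (IsUnitLower L₁ × IsUnitLower L₂ ×
            (∀ i j → B i j ≡ matMul (matMul L₁ antiDiag) L₂ i j)))
lemma8 m B = mk⇔
  (λ (isNet , _) → prefixMapsInjective⇒hasLJL (isNet⇒prefixMapsInjective B isNet))
  (λ (_ , _ , unitLower₁ , unitLower₂ , B≡L₁JL₂) →
     prefixMapsBijective⇒isNet B (factored⇒prefixMapsInjective unitLower₁ unitLower₂ B≡L₁JL₂)
                                 (factored⇒prefixMapsSurjective unitLower₁ unitLower₂ B≡L₁JL₂)
     , λ _ ())
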